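{- Let $Q_0(X,Y)=\alpha X^2+2\beta XY+\gamma Y^2$ with $\alpha,\beta,\gamma\in A=\mathbb F_q[t]$ be a definite binary quadratic form such that $\deg\alpha=\deg\gamma>\deg\beta$ (so the standard basis of $A^2$ is reduced and the successive minima are $\mu_1=\mu_2=\deg\alpha$). Let $a\in A$ be a polynomial of degree $\mu_1$ represented by $Q_0$. Then the group $\mathrm{Aut}(Q_0)=\{U\in\mathrm{GL}_2(A):\ Q_0(U\mathbf x)=Q_0(\mathbf x)\ \text{for all }\mathbf x\in A^2\}$ acts transitively on the set $\{(x,y)\in\mathbb F_q^2:\ Q_0(x,y)=a\}$.
   Context: $\mathbb F_q$ is a finite field with $q$ odd, $A=\mathbb F_q[t]$, $K_\infty=\mathbb F_q((1/t))$; $\deg$ denotes polynomial degree. A binary quadratic form over $A$ is definite if it is anisotropic over $K_\infty$. A basis $\mathbf v_1,\mathbf v_2$ is reduced if, with $m_{ij}=\frac12B(\mathbf v_i,\mathbf v_j)$, $\deg m_{11}\le\deg m_{22}$ and $\deg m_{12}<\deg m_{11}$; the successive minima are $(\deg m_{11},\deg m_{22})$ for a reduced basis. -}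

module Defs where

open import Level using (Level; _⊔_; suc)
open import Algebra.Bundles using (CommutativeRing)
open import Data.Nat as ℕ using (ℕ; zero; _∸_; _≤ᵇ_; _<ᵇ_; _%_)
open import Data.Integer as ℤ using (ℤ; +_; -[1+_])
open import Data.Fin using (Fin)
open import Data.List using (List; []; _∷_; map; length)
open import Data.Bool using (if_then_else_)
open import Data.Product using (Σ; _×_; _,_; ∃; ∃-syntax)
open import Relation.Nullary using (¬_)
open import Relation.Binary.PropositionalEquality as ≡ using (_≡_)
open import Function.Bundles using (Inverse)

record FiniteOddField (c ℓ : Level) : Set (Level.suc (c ⊔ ℓ)) where
  field
    commRing : CommutativeRing c ℓ
  open CommutativeRing commRing public
  field
    1≉0      : ¬ (1# ≈ 0#)
    inverse  : ∀ x → ¬ (x ≈ 0#) → ∃[ y ] (x * y ≈ 1#)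
    q        : ℕ
    enum     : Inverse (≡.setoid (Fin q)) setoid
    q-odd    : q % 2 ≡ 1

module Forms {c ℓ : Level} (F : FiniteOddField c ℓ) where
  open FiniteOddField F

  two : Carrier
  two = 1# + 1#

  -- Polynomials A = F_q[t]: coefficient lists, lowest degree first.
  Poly : Set c
  Poly = List Carrier

  coeff : Poly → ℕ → Carrier
  coeff []      _         = 0#
  coeff (x ∷ p) zero      = x
  coeff (x ∷ p) (ℕ.suc n) = coeff p n

  -- equality of polynomials (coefficientwise, so trailing zeros are irrelevant)
  _≈ₚ_ : Poly → Poly → Set ℓ
  p ≈ₚ r = ∀ n → coeff p n ≈ coeff r n

  const : Carrier → Poly
  const x = x ∷ []

  _+ₚ_ : Poly → Poly → Poly
  []      +ₚ r       = r
  (x ∷ p) +ₚ []      = x ∷ p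
  (x ∷ p) +ₚ (y ∷ r) = (x + y) ∷ (p +ₚ r)

  scale : Carrier → Poly → Poly
  scale x p = map (x *_) p

  _*ₚ_ : Poly → Poly → Poly
  []      *ₚ r = []
  (x ∷ p) *ₚ r = scale x r +ₚ (0# ∷ (p *ₚ r))

  HasDeg : Poly → ℕ → Set ℓ
  HasDeg p d = ¬ (coeff p d ≈ 0#) × (∀ n → d ℕ.< n → coeff p n ≈ 0#)

  -- deg p < d  (includes p = 0, of degree -∞)
  DegLt : Poly → ℕ → Set ℓ
  DegLt p d = ∀ n → d ℕ.≤ n → coeff p n ≈ 0#

  Q : Poly → Poly → Poly → Poly → Poly → Poly
  Q α β γ x y = ((α *ₚ (x *ₚ x)) +ₚ (const two *ₚ (β *ₚ (x *ₚ y)))) +ₚ (γ *ₚ (y *ₚ y))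

  -- K_∞ = F_q((1/t)): a Laurent series in 1/t is  Σ_{s ≥ 0} coef s · t^(shift - s).
  record Laurent : Set c where
    constructor mkL
    field
      shift : ℤ
      coef  : ℕ → Carrier
  open Laurent public

  IsZeroL : Laurent → Set ℓ
  IsZeroL x = ∀ s → coef x s ≈ 0#

  sumTo : (ℕ → Carrier) → ℕ → Carrier
  sumTo h zero      = 0#
  sumTo h (ℕ.suc n) = sumTo h n + h n

  _*L_ : Laurent → Laurent → Laurent
  mkL n f *L mkL p g = mkL (n ℤ.+ p) (λ s → sumTo (λ i → f i * g (s ∸ i)) (ℕ.suc s))

  -- same series, shift raised by k
  delay : ℕ → (ℕ → Carrier) → ℕ → Carrier
  delay k f s = if s <ᵇ k then 0# else f (s ∸ k)

  _+L_ : Laurent → Laurent → Laurent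
  mkL n f +L mkL p g with n ℤ.- p
  ... | + k      = mkL n (λ s → f s + delay k g s)
  ... | -[1+ k ] = mkL p (λ s → delay (ℕ.suc k) f s + g s)

  toL : Poly → Laurent
  toL p = mkL (+ length p)
              (λ s → if s ≤ᵇ length p then coeff p (length p ∸ s) else 0#)

  QL : Poly → Poly → Poly → Laurent → Laurent → Laurent
  QL α β γ x y =
    ((toL α *L (x *L x)) +L (toL (const two) *L (toL β *L (x *L y)))) +L (toL γ *L (y *L y))

  -- definite = anisotropic over K_∞
  Definite : Poly → Poly → Poly → Set (c ⊔ ℓ)
  Definite α β γ = ∀ (x y : Laurent) → IsZeroL (QL α β γ x y) → IsZeroL x × IsZeroL y

  record Mat : Set c where
    constructor mat
    field
      m11 m12 m21 m22 : Poly
  open Mat public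

  _·_ : Mat → Mat → Mat
  mat a b c' d · mat e f g h =
    mat ((a *ₚ e) +ₚ (b *ₚ g)) ((a *ₚ f) +ₚ (b *ₚ h))
        ((c' *ₚ e) +ₚ (d *ₚ g)) ((c' *ₚ f) +ₚ (d *ₚ h))

  I₂ : Mat
  I₂ = mat (const 1#) (const 0#) (const 0#) (const 1#)

  _≈ₘ_ : Mat → Mat → Set ℓ
  U ≈ₘ V = (m11 U ≈ₚ m11 V) × (m12 U ≈ₚ m12 V) × (m21 U ≈ₚ m21 V) × (m22 U ≈ₚ m22 V)

  act : Mat → Poly × Poly → Poly × Poly
  act (mat a b c' d) (x , y) = ((a *ₚ x) +ₚ (b *ₚ y)) , ((c' *ₚ x) +ₚ (d *ₚ y))

  InGL₂ : Mat → Set (c ⊔ ℓ)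
  InGL₂ U = ∃[ V ] ((U · V) ≈ₘ I₂ × (V · U) ≈ₘ I₂)

  InAut : Poly → Poly → Poly → Mat → Set (c ⊔ ℓ)
  InAut α β γ U =
    InGL₂ U ×
    (∀ (x y : Poly) → let (x' , y') = act U (x , y) in Q α β γ x' y' ≈ₚ Q α β γ x y)

-- Comparing coefficients of t^n, Q(x, y) = Q(x', y') for constant
-- vectors v = (x, y), v' = (x', y') says that every coefficient form
-- q_n = α_n X² + 2 β_n X Y + γ_n Y² over F_q takes the same value at v and v'.
-- If v, v' are independent, the reflection of F_q² exchanging them preserves
-- every q_n; otherwise v' = λ v, and λ² = 1 because q_μ(v) = a_μ ≠ 0, so λ·I
-- works.  A constant matrix preserving every q_n preserves Q on all of A², and
-- both matrices are involutions, hence in GL₂(A).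
module Submission where

open import Defs
open import Level using (Level)
open import Algebra.Bundles using (CommutativeRing; AbelianGroup)
open import Data.Nat as ℕ using (ℕ; zero; suc)
import Data.Nat.Properties as ℕ
open import Data.Integer as ℤ using (ℤ; +_; -[1+_])
import Data.Integer.Properties as ℤ
open import Data.Sign as Sign using (Sign)
open import Data.Maybe using (Maybe; just; nothing)
open import Data.List using ([]; _∷_; map)
open import Data.Product using (_×_; _,_; ∃-syntax; proj₁; proj₂)
import Data.Fin.Properties as Fin
open import Function.Bundles using (Inverse)
open import Relation.Nullary using (¬_; yes; no; contradiction)
open import Relation.Nullary.Decidable using (map′)
open import Relation.Binary.Bundles using (Setoid)
open import Relation.Binary.Structures using (IsEquivalence)
open import Relation.Binary.Definitions using (Decidable)
import Relation.Binary.PropositionalEquality as ≡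
import Relation.Binary.Reasoning.Setoid as SetoidReasoning
import Algebra.Solver.Ring
open import Algebra.Solver.Ring.AlmostCommutativeRing
  using (_-Raw-AlmostCommutative⟶_; fromCommutativeRing)

module IntegerRingSolver {c ℓ} (R : CommutativeRing c ℓ) where

  open CommutativeRing R
  open import Algebra.Properties.Ring ring using (-‿distribˡ-*; -‿distribʳ-*)
  open import Algebra.Properties.AbelianGroup +-abelianGroup using (⁻¹-∙-comm)
  open import Algebra.Properties.Group +-group using (ε⁻¹≈ε; ⁻¹-involutive)
  open import Algebra.Properties.CommutativeSemigroup +-commutativeSemigroup using (interchange)
  open import Algebra.Properties.Semiring.Mult.TCOptimised semiring
    using (1+×; ×-homo-+; ×1-homo-*) renaming (_×_ to _×′_)
  open import Relation.Binary.Reasoning.Setoid setoid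

  private
    -- The type-checking-optimised _×′_ makes fromℤ (+ 2) reduce to 1# + 1#,
    -- the constant two of Forms.
    fromℤ : ℤ → Carrier
    fromℤ (+ n)    = n ×′ 1#
    fromℤ -[1+ n ] = - (suc n ×′ 1#)

    signed : Sign → Carrier → Carrier
    signed Sign.+ x = x
    signed Sign.- x = - x

    signed-cong : ∀ s {x y} → x ≈ y → signed s x ≈ signed s y
    signed-cong Sign.+ x≈y = x≈y
    signed-cong Sign.- x≈y = -‿cong x≈y

    signed-* : ∀ s t x y → signed (s Sign.* t) (x * y) ≈ signed s x * signed t y
    signed-* Sign.+ Sign.+ x y = refl
    signed-* Sign.+ Sign.- x y = -‿distribʳ-* x y
    signed-* Sign.- Sign.+ x y = -‿distribˡ-* x y
    signed-* Sign.- Sign.- x y = begin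
      x * y           ≈⟨ ⁻¹-involutive (x * y) ⟨
      - - (x * y)     ≈⟨ -‿cong (-‿distribˡ-* x y) ⟩
      - (- x * y)     ≈⟨ -‿distribʳ-* (- x) y ⟩
      - x * - y       ∎

    fromℤ-signAbs : ∀ i → fromℤ i ≈ signed (ℤ.sign i) (ℤ.∣ i ∣ ×′ 1#)
    fromℤ-signAbs (+ zero)  = refl
    fromℤ-signAbs (+ suc n) = refl
    fromℤ-signAbs -[1+ n ]  = refl

    fromℤ-◃ : ∀ s n → fromℤ (s ℤ.◃ n) ≈ signed s (n ×′ 1#)
    fromℤ-◃ Sign.+ zero    = refl
    fromℤ-◃ Sign.- zero    = sym ε⁻¹≈ε
    fromℤ-◃ Sign.+ (suc n) = refl
    fromℤ-◃ Sign.- (suc n) = refl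

    fromℤ-⊖ : ∀ m n → fromℤ (m ℤ.⊖ n) ≈ m ×′ 1# - n ×′ 1#
    fromℤ-⊖ zero    zero    = sym (trans (+-identityˡ _) ε⁻¹≈ε)
    fromℤ-⊖ zero    (suc n) = sym (+-identityˡ _)
    fromℤ-⊖ (suc m) zero    = sym (trans (+-congˡ ε⁻¹≈ε) (+-identityʳ _))
    fromℤ-⊖ (suc m) (suc n) = begin
      fromℤ (suc m ℤ.⊖ suc n)            ≡⟨ ≡.cong fromℤ (ℤ.[1+m]⊖[1+n]≡m⊖n m n) ⟩
      fromℤ (m ℤ.⊖ n)                    ≈⟨ fromℤ-⊖ m n ⟩
      m ×′ 1# - n ×′ 1#                  ≈⟨ cancel 1# (m ×′ 1#) (n ×′ 1#) ⟨
      (1# + m ×′ 1#) - (1# + n ×′ 1#)    ≈⟨ +-cong (1+× m 1#) (-‿cong (1+× n 1#)) ⟨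
      suc m ×′ 1# - suc n ×′ 1#          ∎
      where
      cancel : ∀ a x y → (a + x) - (a + y) ≈ x - y
      cancel a x y = begin
        (a + x) - (a + y)      ≈⟨ +-congˡ (⁻¹-∙-comm a y) ⟨
        (a + x) + (- a - y)    ≈⟨ interchange a x (- a) (- y) ⟩
        (a - a) + (x - y)      ≈⟨ +-congʳ (-‿inverseʳ a) ⟩
        0# + (x - y)           ≈⟨ +-identityˡ (x - y) ⟩
        x - y                  ∎

    +-homo : ∀ i j → fromℤ (i ℤ.+ j) ≈ fromℤ i + fromℤ j
    +-homo (+ m)    (+ n)    = ×-homo-+ 1# m n
    +-homo (+ m)    -[1+ n ] = fromℤ-⊖ m (suc n)
    +-homo -[1+ m ] (+ n)    = trans (fromℤ-⊖ n (suc m)) (+-comm _ _)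
    +-homo -[1+ m ] -[1+ n ] = begin
      - (suc (suc (m ℕ.+ n)) ×′ 1#)        ≡⟨ ≡.cong (λ k → - (suc k ×′ 1#)) (ℕ.+-suc m n) ⟨
      - ((suc m ℕ.+ suc n) ×′ 1#)          ≈⟨ -‿cong (×-homo-+ 1# (suc m) (suc n)) ⟩
      - (suc m ×′ 1# + suc n ×′ 1#)        ≈⟨ ⁻¹-∙-comm _ _ ⟨
      - (suc m ×′ 1#) + - (suc n ×′ 1#)    ∎

    *-homo : ∀ i j → fromℤ (i ℤ.* j) ≈ fromℤ i * fromℤ j
    *-homo i j = begin
      fromℤ ((sᵢ Sign.* sⱼ) ℤ.◃ (nᵢ ℕ.* nⱼ))            ≈⟨ fromℤ-◃ (sᵢ Sign.* sⱼ) (nᵢ ℕ.* nⱼ) ⟩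
      signed (sᵢ Sign.* sⱼ) ((nᵢ ℕ.* nⱼ) ×′ 1#)         ≈⟨ signed-cong (sᵢ Sign.* sⱼ) (×1-homo-* nᵢ nⱼ) ⟩
      signed (sᵢ Sign.* sⱼ) ((nᵢ ×′ 1#) * (nⱼ ×′ 1#))   ≈⟨ signed-* sᵢ sⱼ _ _ ⟩
      signed sᵢ (nᵢ ×′ 1#) * signed sⱼ (nⱼ ×′ 1#)       ≈⟨ *-cong (fromℤ-signAbs i) (fromℤ-signAbs j) ⟨
      fromℤ i * fromℤ j                                 ∎
      where
      sᵢ sⱼ : Sign
      sᵢ = ℤ.sign i
      sⱼ = ℤ.sign j
      nᵢ nⱼ : ℕ
      nᵢ = ℤ.∣ i ∣
      nⱼ = ℤ.∣ j ∣

    -‿homo : ∀ i → fromℤ (ℤ.- i) ≈ - fromℤ i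
    -‿homo (+ zero)  = sym ε⁻¹≈ε
    -‿homo (+ suc n) = refl
    -‿homo -[1+ n ]  = sym (⁻¹-involutive _)

    homomorphism : ℤ.+-*-rawRing -Raw-AlmostCommutative⟶ fromCommutativeRing R
    homomorphism = record
      { ⟦_⟧ = fromℤ ; +-homo = +-homo ; *-homo = *-homo ; -‿homo = -‿homo
      ; 0-homo = refl ; 1-homo = refl }

    equal? : ∀ i j → Maybe (fromℤ i ≈ fromℤ j)
    equal? i j with i ℤ.≟ j
    ... | yes ≡.refl = just refl
    ... | no _       = nothing

  open Algebra.Solver.Ring ℤ.+-*-rawRing (fromCommutativeRing R) homomorphism equal? public

module BinaryForms {r₁ r₂} (R : CommutativeRing r₁ r₂) where

  open CommutativeRing R
  open IntegerRingSolver R using (solve; _:=_; _:+_; _:*_; _:-_; con; Polynomial)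
  open import Algebra.Properties.Group +-group using (x≈y⇒x∙y⁻¹≈ε)

  form : (a b c x y : Carrier) → Carrier
  form a b c x y = a * (x * x) + (1# + 1#) * (b * (x * y)) + c * (y * y)

  polar : (a b c x y x' y' : Carrier) → Carrier
  polar a b c x y x' y' = a * (x * x') + b * (x * y' + y * x') + c * (y * y')

  :form : ∀ {n} → (a b c x y : Polynomial n) → Polynomial n
  :form a b c x y = a :* (x :* x) :+ con (+ 2) :* (b :* (x :* y)) :+ c :* (y :* y)

  :polar : ∀ {n} → (a b c x y x' y' : Polynomial n) → Polynomial n
  :polar a b c x y x' y' = a :* (x :* x') :+ b :* (x :* y' :+ y :* x') :+ c :* (y :* y')

  form-cong : ∀ {a a' b b' c c' x x' y y'} → a ≈ a' → b ≈ b' → c ≈ c' → x ≈ x' → y ≈ y' →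
              form a b c x y ≈ form a' b' c' x' y'
  form-cong a≈a' b≈b' c≈c' x≈x' y≈y' =
    +-cong (+-cong (*-cong a≈a' (*-cong x≈x' x≈x'))
                   (*-congˡ (*-cong b≈b' (*-cong x≈x' y≈y'))))
           (*-cong c≈c' (*-cong y≈y' y≈y'))

  form-zero : ∀ a b c → form a b c 0# 0# ≈ 0#
  form-zero = solve 3 (λ a b c → :form a b c (con (+ 0)) (con (+ 0)) := con (+ 0)) refl

  form-scale : ∀ a b c l x y → form a b c (l * x) (l * y) ≈ (l * l) * form a b c x y
  form-scale = solve 6 (λ a b c l x y → :form a b c (l :* x) (l :* y) := (l :* l) :* :form a b c x y) refl

  form-substitution : ∀ a b c s t s' t' x y →
    form a b c (s * x + t * y) (s' * x + t' * y) ≈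
    form (form a b c s s') (polar a b c s s' t t') (form a b c t t') x y
  form-substitution = solve 9 (λ a b c s t s' t' x y →
    :form a b c (s :* x :+ t :* y) (s' :* x :+ t' :* y) :=
    :form (:form a b c s s') (:polar a b c s s' t t') (:form a b c t t') x y) refl

  record Matrix : Set r₁ where
    constructor matrix
    field e₁₁ e₁₂ e₂₁ e₂₂ : Carrier

  IsInvolution : Matrix → Set r₂
  IsInvolution (matrix s t s' t') =
    (s * s + t * s' ≈ 1#) × (s * t + t * t' ≈ 0#) × (s' * s + t' * s' ≈ 0#) × (s' * t + t' * t' ≈ 1#)

  Sends : Matrix → (x y x' y' : Carrier) → Set r₂
  Sends (matrix s t s' t') x y x' y' = (s * x + t * y ≈ x') × (s' * x + t' * y ≈ y')

  -- Uᵀ G U = G for the Gram matrix G of the form.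
  Preserves : Matrix → (a b c : Carrier) → Set r₂
  Preserves (matrix s t s' t') a b c =
    (form a b c s s' ≈ a) × (polar a b c s s' t t' ≈ b) × (form a b c t t' ≈ c)

  preserves⇒form-invariant : ∀ {s t s' t' a b c} → Preserves (matrix s t s' t') a b c →
    ∀ x y → form a b c (s * x + t * y) (s' * x + t' * y) ≈ form a b c x y
  preserves⇒form-invariant {s} {t} {s'} {t'} {a} {b} {c} (a≈ , b≈ , c≈) x y =
    trans (form-substitution a b c s t s' t' x y) (form-cong a≈ b≈ c≈ refl refl)

  scalar : Carrier → Matrix
  scalar l = matrix l 0# 0# l

  scalar-sends : ∀ {l x y x' y'} → l * x ≈ x' → l * y ≈ y' → Sends (scalar l) x y x' y'
  scalar-sends {l} {x} {y} lx≈x' ly≈y' =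
    trans (+-congˡ (zeroˡ y)) (trans (+-identityʳ _) lx≈x') ,
    trans (+-congʳ (zeroˡ x)) (trans (+-identityˡ _) ly≈y')

  module _ {l} (l²≈1 : l * l ≈ 1#) where

    private
      via-l² : ∀ {u v} → u ≈ (l * l) * v → u ≈ v
      via-l² u≈l²v = trans u≈l²v (trans (*-congʳ l²≈1) (*-identityˡ _))

    scalar-involution : IsInvolution (scalar l)
    scalar-involution =
      via-l² (solve 1 (λ l → l :* l :+ con (+ 0) :* con (+ 0) := (l :* l) :* con (+ 1)) refl l) ,
      solve 1 (λ l → l :* con (+ 0) :+ con (+ 0) :* l := con (+ 0)) refl l ,
      solve 1 (λ l → con (+ 0) :* l :+ l :* con (+ 0) := con (+ 0)) refl l ,
      via-l² (solve 1 (λ l → con (+ 0) :* con (+ 0) :+ l :* l := (l :* l) :* con (+ 1)) refl l)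

    scalar-preserves : ∀ a b c → Preserves (scalar l) a b c
    scalar-preserves a b c =
      via-l² (solve 4 (λ a b c l → :form a b c l (con (+ 0)) := (l :* l) :* a) refl a b c l) ,
      via-l² (solve 4 (λ a b c l → :polar a b c l (con (+ 0)) (con (+ 0)) l := (l :* l) :* b) refl a b c l) ,
      via-l² (solve 4 (λ a b c l → :form a b c (con (+ 0)) l := (l :* l) :* c) refl a b c l)

  -- The reflection exchanging two linearly independent vectors v, v'.  It is an
  -- isometry of every form q with q(v) = q(v'), because
  -- q(λv + μv') = λ²q(v) + 2λμ·polar(v,v') + μ²q(v') is then symmetric in λ, μ.
  module Reflection (x y x' y' e : Carrier) (det-inverse : (x * y' - x' * y) * e ≈ 1#) where

    reflection : Matrix
    reflection =
      matrix (e * (x' * y' - x * y)) (e * (x * x - x' * x')) (e * (y' * y' - y * y)) (e * (x * y - x' * y'))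

    private
      d : Carrier
      d = x * y' - x' * y

      via-de : ∀ {u v} → u ≈ ((d * e) * (d * e)) * v → u ≈ v
      via-de u≈v = trans u≈v (trans (*-congʳ de²≈1) (*-identityˡ _))
        where
        de²≈1 : (d * e) * (d * e) ≈ 1#
        de²≈1 = trans (*-cong det-inverse det-inverse) (*-identityʳ 1#)

      :reflection : ∀ {n} → (x y x' y' e : Polynomial n) → Polynomial n × Polynomial n × Polynomial n × Polynomial n
      :reflection x y x' y' e =
        e :* (x' :* y' :- x :* y) , e :* (x :* x :- x' :* x') , e :* (y' :* y' :- y :* y) , e :* (x :* y :- x' :* y')

      :det : ∀ {n} → (x y x' y' : Polynomial n) → Polynomial n
      :det x y x' y' = x :* y' :- x' :* y

    reflection-involution : IsInvolution reflection
    reflection-involution =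
      via-de (solve 5 (λ x y x' y' e → let s , t , s' , t' = :reflection x y x' y' e ; de = :det x y x' y' :* e in
        s :* s :+ t :* s' := (de :* de) :* con (+ 1)) refl x y x' y' e) ,
      solve 5 (λ x y x' y' e → let s , t , s' , t' = :reflection x y x' y' e in
        s :* t :+ t :* t' := con (+ 0)) refl x y x' y' e ,
      solve 5 (λ x y x' y' e → let s , t , s' , t' = :reflection x y x' y' e in
        s' :* s :+ t' :* s' := con (+ 0)) refl x y x' y' e ,
      via-de (solve 5 (λ x y x' y' e → let s , t , s' , t' = :reflection x y x' y' e ; de = :det x y x' y' :* e in
        s' :* t :+ t' :* t' := (de :* de) :* con (+ 1)) refl x y x' y' e)

    reflection-sends : Sends reflection x y x' y'
    reflection-sends =
      trans (solve 5 (λ x y x' y' e → let s , t , s' , t' = :reflection x y x' y' e in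
        s :* x :+ t :* y := x' :* (:det x y x' y' :* e)) refl x y x' y' e)
        (trans (*-congˡ det-inverse) (*-identityʳ x')) ,
      trans (solve 5 (λ x y x' y' e → let s , t , s' , t' = :reflection x y x' y' e in
        s' :* x :+ t' :* y := y' :* (:det x y x' y' :* e)) refl x y x' y' e)
        (trans (*-congˡ det-inverse) (*-identityʳ y'))

    reflection-preserves : ∀ a b c → form a b c x y ≈ form a b c x' y' → Preserves reflection a b c
    reflection-preserves a b c q[v]≈q[v'] =
      up-to-Δ (solve 8 (λ x y x' y' e a b c →
        let s , t , s' , t' = :reflection x y x' y' e ; de = :det x y x' y' :* e in
        :form a b c s s'
          := (de :* de) :* a :+ (e :* e) :* ((y' :* y' :- y :* y) :* (:form a b c x' y' :- :form a b c x y)))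
        refl x y x' y' e a b c) ,
      up-to-Δ (solve 8 (λ x y x' y' e a b c →
        let s , t , s' , t' = :reflection x y x' y' e ; de = :det x y x' y' :* e in
        :polar a b c s s' t t'
          := (de :* de) :* b :+ (e :* e) :* ((x :* y :- x' :* y') :* (:form a b c x' y' :- :form a b c x y)))
        refl x y x' y' e a b c) ,
      up-to-Δ (solve 8 (λ x y x' y' e a b c →
        let s , t , s' , t' = :reflection x y x' y' e ; de = :det x y x' y' :* e in
        :form a b c t t'
          := (de :* de) :* c :+ (e :* e) :* ((x' :* x' :- x :* x) :* (:form a b c x' y' :- :form a b c x y)))
        refl x y x' y' e a b c)
      where
      Δ≈0 : form a b c x' y' - form a b c x y ≈ 0#
      Δ≈0 = x≈y⇒x∙y⁻¹≈ε (sym q[v]≈q[v'])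
      up-to-Δ : ∀ {u v K} → v ≈ ((d * e) * (d * e)) * u + (e * e) * (K * (form a b c x' y' - form a b c x y)) →
                v ≈ u
      up-to-Δ {u} {v} {K} v≈ = trans v≈ (trans (+-congˡ Δ-term≈0) (trans (+-identityʳ _) (via-de refl)))
        where
        Δ-term≈0 : (e * e) * (K * (form a b c x' y' - form a b c x y)) ≈ 0#
        Δ-term≈0 = trans (*-congˡ (trans (*-congˡ Δ≈0) (zeroʳ K))) (zeroʳ _)

module DiscreteFieldForms {r₁ r₂} (R : CommutativeRing r₁ r₂) where

  open CommutativeRing R
  open BinaryForms R
  open import Algebra.Properties.Group +-group using (x∙y⁻¹≈ε⇒x≈y)
  open import Algebra.Properties.CommutativeSemigroup *-commutativeSemigroup using (xy∙z≈y∙xz)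
  open SetoidReasoning setoid

  module _ (inverse : ∀ x → ¬ x ≈ 0# → ∃[ y ] x * y ≈ 1#) (_≟_ : Decidable _≈_) where

    *-cancelʳ-nonzero : ∀ {a b k} → ¬ k ≈ 0# → a * k ≈ b * k → a ≈ b
    *-cancelʳ-nonzero {a} {b} {k} k≉0 ak≈bk with inverse k k≉0
    ... | k⁻¹ , kk⁻¹≈1 = begin
      a                 ≈⟨ *-identityʳ a ⟨
      a * 1#            ≈⟨ *-congˡ kk⁻¹≈1 ⟨
      a * (k * k⁻¹)     ≈⟨ *-assoc a k k⁻¹ ⟨
      (a * k) * k⁻¹     ≈⟨ *-congʳ ak≈bk ⟩
      (b * k) * k⁻¹     ≈⟨ *-assoc b k k⁻¹ ⟩
      b * (k * k⁻¹)     ≈⟨ *-congˡ kk⁻¹≈1 ⟩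
      b * 1#            ≈⟨ *-identityʳ b ⟩
      b                 ∎

    proportional : ∀ {x y x' y'} → ¬ x ≈ 0# → x * y' ≈ x' * y → ∃[ l ] l * x ≈ x' × l * y ≈ y'
    proportional {x} {y} {x'} {y'} x≉0 xy'≈x'y with inverse x x≉0
    ... | x⁻¹ , xx⁻¹≈1 = x' * x⁻¹ , l*x≈x' , l*y≈y'
      where
      x⁻¹x≈1 : x⁻¹ * x ≈ 1#
      x⁻¹x≈1 = trans (*-comm x⁻¹ x) xx⁻¹≈1
      l*x≈x' : (x' * x⁻¹) * x ≈ x'
      l*x≈x' = trans (*-assoc x' x⁻¹ x) (trans (*-congˡ x⁻¹x≈1) (*-identityʳ x'))
      l*y≈y' : (x' * x⁻¹) * y ≈ y'
      l*y≈y' = begin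
        (x' * x⁻¹) * y     ≈⟨ xy∙z≈y∙xz x' x⁻¹ y ⟩
        x⁻¹ * (x' * y)     ≈⟨ *-congˡ xy'≈x'y ⟨
        x⁻¹ * (x * y')     ≈⟨ *-assoc x⁻¹ x y' ⟨
        (x⁻¹ * x) * y'     ≈⟨ *-congʳ x⁻¹x≈1 ⟩
        1# * y'            ≈⟨ *-identityˡ y' ⟩
        y'                 ∎

    collinear⇒proportional : ∀ {x y x' y'} → x * y' ≈ x' * y → ¬ (x ≈ 0# × y ≈ 0#) →
                             ∃[ l ] l * x ≈ x' × l * y ≈ y'
    collinear⇒proportional {x} {y} {x'} {y'} xy'≈x'y v≉0 with x ≟ 0# | y ≟ 0#
    ... | no x≉0  | _       = proportional x≉0 xy'≈x'y
    ... | yes _   | no y≉0  =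
      let l , ly≈y' , lx≈x' = proportional y≉0 (trans (*-comm y x') (trans (sym xy'≈x'y) (*-comm x y')))
      in l , lx≈x' , ly≈y'
    ... | yes x≈0 | yes y≈0 = contradiction (x≈0 , y≈0) v≉0

    module _ {i} {I : Set i} (A B C : I → Carrier) where

      exchanging-involution : ∀ {x y x' y'} (μ : I) → ¬ form (A μ) (B μ) (C μ) x y ≈ 0# →
        (∀ n → form (A n) (B n) (C n) x y ≈ form (A n) (B n) (C n) x' y') →
        ∃[ U ] IsInvolution U × Sends U x y x' y' × (∀ n → Preserves U (A n) (B n) (C n))
      exchanging-involution {x} {y} {x'} {y'} μ q[v]≉0 q[v]≈q[v'] with (x * y' - x' * y) ≟ 0#
      ... | no det≉0 =
        let e , de≈1 = inverse _ det≉0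
            open Reflection x y x' y' e de≈1
        in reflection , reflection-involution , reflection-sends ,
           λ n → reflection-preserves (A n) (B n) (C n) (q[v]≈q[v'] n)
      ... | yes det≈0 =
        let l , lx≈x' , ly≈y' = collinear⇒proportional (x∙y⁻¹≈ε⇒x≈y _ _ det≈0) v≉0
            l²≈1 = *-cancelʳ-nonzero q[v]≉0 (begin
              (l * l) * q[v]                          ≈⟨ form-scale (A μ) (B μ) (C μ) l x y ⟨
              form (A μ) (B μ) (C μ) (l * x) (l * y)  ≈⟨ form-cong refl refl refl lx≈x' ly≈y' ⟩
              form (A μ) (B μ) (C μ) x' y'            ≈⟨ q[v]≈q[v'] μ ⟨
              q[v]                                    ≈⟨ *-identityˡ q[v] ⟨
              1# * q[v]                               ∎)
        in scalar l , scalar-involution l²≈1 , scalar-sends lx≈x' ly≈y' ,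
           λ n → scalar-preserves l²≈1 (A n) (B n) (C n)
        where
        q[v] : Carrier
        q[v] = form (A μ) (B μ) (C μ) x y
        v≉0 : ¬ (x ≈ 0# × y ≈ 0#)
        v≉0 (x≈0 , y≈0) = q[v]≉0 (trans (form-cong refl refl refl x≈0 y≈0) (form-zero (A μ) (B μ) (C μ)))

module Polynomials {r₁ r₂} (F : FiniteOddField r₁ r₂) where

  open FiniteOddField F hiding (zero)
  open Forms F
  open import Algebra.Properties.Group +-group using (ε⁻¹≈ε)

  -- _≈ₚ_ is a Π-type, from which Agda cannot recover the polynomials it
  -- relates; this wrapper lets them be inferred.
  infix 4 _≋_
  record _≋_ (p r : Poly) : Set r₂ where
    constructor coeffwise
    field coeff≈ : p ≈ₚ r
  open _≋_ public

  private
    variable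
      k : Carrier
      p p' r r' : Poly

  infix 25 X·_
  X·_ : Poly → Poly
  X· p = 0# ∷ p

  -ₚ_ : Poly → Poly
  -ₚ p = map -_ p

  coeff-+ₚ : ∀ p r n → coeff (p +ₚ r) n ≈ coeff p n + coeff r n
  coeff-+ₚ []      r       n       = sym (+-identityˡ _)
  coeff-+ₚ (x ∷ p) []      n       = sym (+-identityʳ _)
  coeff-+ₚ (x ∷ p) (y ∷ r) zero    = refl
  coeff-+ₚ (x ∷ p) (y ∷ r) (suc n) = coeff-+ₚ p r n

  coeff-scale : ∀ k p n → coeff (scale k p) n ≈ k * coeff p n
  coeff-scale k []      n       = sym (zeroʳ k)
  coeff-scale k (x ∷ p) zero    = refl
  coeff-scale k (x ∷ p) (suc n) = coeff-scale k p n

  coeff-negate : ∀ p n → coeff (-ₚ p) n ≈ - coeff p n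
  coeff-negate []      n       = sym ε⁻¹≈ε
  coeff-negate (x ∷ p) zero    = refl
  coeff-negate (x ∷ p) (suc n) = coeff-negate p n

  ≋-isEquivalence : IsEquivalence _≋_
  ≋-isEquivalence = record
    { refl  = coeffwise λ n → refl
    ; sym   = λ e → coeffwise λ n → sym (coeff≈ e n)
    ; trans = λ e f → coeffwise λ n → trans (coeff≈ e n) (coeff≈ f n)
    }

  ≋-setoid : Setoid r₁ r₂
  ≋-setoid = record { isEquivalence = ≋-isEquivalence }

  ∷-cong : ∀ {x y} → x ≈ y → p ≋ r → (x ∷ p) ≋ (y ∷ r)
  ∷-cong x≈y e = coeffwise λ { zero → x≈y ; (suc n) → coeff≈ e n }

  +ₚ-abelianGroup : AbelianGroup r₁ r₂
  +ₚ-abelianGroup = record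
    { Carrier = Poly ; _≈_ = _≋_ ; _∙_ = _+ₚ_ ; ε = [] ; _⁻¹ = -ₚ_
    ; isAbelianGroup = record
      { isGroup = record
        { isMonoid = record
          { isSemigroup = record
            { isMagma = record { isEquivalence = ≋-isEquivalence ; ∙-cong = +ₚ-cong }
            ; assoc = +ₚ-assoc }
          ; identity = (λ p → coeffwise λ n → refl) , +ₚ-identityʳ }
        ; inverse = -ₚ-inverseˡ , -ₚ-inverseʳ
        ; ⁻¹-cong = -ₚ-cong }
      ; comm = +ₚ-comm }
    }
    where
    open SetoidReasoning setoid
    +ₚ-cong : p ≋ p' → r ≋ r' → p +ₚ r ≋ p' +ₚ r'
    +ₚ-cong {p} {p'} {r} {r'} e f = coeffwise λ n → begin
      coeff (p +ₚ r) n            ≈⟨ coeff-+ₚ p r n ⟩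
      coeff p n + coeff r n       ≈⟨ +-cong (coeff≈ e n) (coeff≈ f n) ⟩
      coeff p' n + coeff r' n     ≈⟨ coeff-+ₚ p' r' n ⟨
      coeff (p' +ₚ r') n          ∎
    +ₚ-assoc : ∀ p r s → (p +ₚ r) +ₚ s ≋ p +ₚ (r +ₚ s)
    +ₚ-assoc p r s = coeffwise λ n → begin
      coeff ((p +ₚ r) +ₚ s) n                ≈⟨ coeff-+ₚ (p +ₚ r) s n ⟩
      coeff (p +ₚ r) n + coeff s n           ≈⟨ +-congʳ (coeff-+ₚ p r n) ⟩
      (coeff p n + coeff r n) + coeff s n    ≈⟨ +-assoc _ _ _ ⟩
      coeff p n + (coeff r n + coeff s n)    ≈⟨ +-congˡ (coeff-+ₚ r s n) ⟨
      coeff p n + coeff (r +ₚ s) n           ≈⟨ coeff-+ₚ p (r +ₚ s) n ⟨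
      coeff (p +ₚ (r +ₚ s)) n                ∎
    +ₚ-identityʳ : ∀ p → p +ₚ [] ≋ p
    +ₚ-identityʳ p = coeffwise λ n → trans (coeff-+ₚ p [] n) (+-identityʳ _)
    +ₚ-comm : ∀ p r → p +ₚ r ≋ r +ₚ p
    +ₚ-comm p r = coeffwise λ n → trans (coeff-+ₚ p r n) (trans (+-comm _ _) (sym (coeff-+ₚ r p n)))
    -ₚ-cong : p ≋ r → -ₚ p ≋ -ₚ r
    -ₚ-cong {p} {r} e = coeffwise λ n →
      trans (coeff-negate p n) (trans (-‿cong (coeff≈ e n)) (sym (coeff-negate r n)))
    -ₚ-inverseˡ : ∀ p → (-ₚ p) +ₚ p ≋ []
    -ₚ-inverseˡ p = coeffwise λ n →
      trans (coeff-+ₚ (-ₚ p) p n) (trans (+-congʳ (coeff-negate p n)) (-‿inverseˡ _))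
    -ₚ-inverseʳ : ∀ p → p +ₚ (-ₚ p) ≋ []
    -ₚ-inverseʳ p = coeffwise λ n →
      trans (coeff-+ₚ p (-ₚ p) n) (trans (+-congˡ (coeff-negate p n)) (-‿inverseʳ _))

  private
    module +ₚ = AbelianGroup +ₚ-abelianGroup
  open import Algebra.Properties.CommutativeSemigroup +ₚ.commutativeSemigroup
    using (interchange; x∙yz≈y∙xz)

  X·-+ₚ : ∀ p r → X· (p +ₚ r) ≋ X· p +ₚ X· r
  X·-+ₚ p r = ∷-cong (sym (+-identityʳ 0#)) +ₚ.refl

  scale-cong : p ≋ r → scale k p ≋ scale k r
  scale-cong {p} {r} {k} e = coeffwise λ n →
    trans (coeff-scale k p n) (trans (*-congˡ (coeff≈ e n)) (sym (coeff-scale k r n)))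

  scale-+ₚ : ∀ k p r → scale k (p +ₚ r) ≋ scale k p +ₚ scale k r
  scale-+ₚ k p r = coeffwise λ n → begin
    coeff (scale k (p +ₚ r)) n                 ≈⟨ coeff-scale k (p +ₚ r) n ⟩
    k * coeff (p +ₚ r) n                       ≈⟨ *-congˡ (coeff-+ₚ p r n) ⟩
    k * (coeff p n + coeff r n)                ≈⟨ distribˡ k _ _ ⟩
    k * coeff p n + k * coeff r n              ≈⟨ +-cong (coeff-scale k p n) (coeff-scale k r n) ⟨
    coeff (scale k p) n + coeff (scale k r) n  ≈⟨ coeff-+ₚ (scale k p) _ n ⟨
    coeff (scale k p +ₚ scale k r) n           ∎
    where open SetoidReasoning setoid

  scale-distribʳ : ∀ k l p → scale (k + l) p ≋ scale k p +ₚ scale l p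
  scale-distribʳ k l p = coeffwise λ n → begin
    coeff (scale (k + l) p) n                  ≈⟨ coeff-scale (k + l) p n ⟩
    (k + l) * coeff p n                        ≈⟨ distribʳ _ k l ⟩
    k * coeff p n + l * coeff p n              ≈⟨ +-cong (coeff-scale k p n) (coeff-scale l p n) ⟨
    coeff (scale k p) n + coeff (scale l p) n  ≈⟨ coeff-+ₚ (scale k p) _ n ⟨
    coeff (scale k p +ₚ scale l p) n           ∎
    where open SetoidReasoning setoid

  scale-* : ∀ k l p → scale (k * l) p ≋ scale k (scale l p)
  scale-* k l p = coeffwise λ n → begin
    coeff (scale (k * l) p) n       ≈⟨ coeff-scale (k * l) p n ⟩
    (k * l) * coeff p n             ≈⟨ *-assoc k l _ ⟩
    k * (l * coeff p n)             ≈⟨ *-congˡ (coeff-scale l p n) ⟨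
    k * coeff (scale l p) n         ≈⟨ coeff-scale k (scale l p) n ⟨
    coeff (scale k (scale l p)) n   ∎
    where open SetoidReasoning setoid

  scale-zero : ∀ p → scale 0# p ≋ []
  scale-zero p = coeffwise λ n → trans (coeff-scale 0# p n) (zeroˡ _)

  scale-one : ∀ p → scale 1# p ≋ p
  scale-one p = coeffwise λ n → trans (coeff-scale 1# p n) (*-identityˡ _)

  X·-zero : X· [] ≋ []
  X·-zero = coeffwise λ { zero → refl ; (suc n) → refl }

  scale-X· : ∀ k p → scale k (X· p) ≋ X· scale k p
  scale-X· k p = ∷-cong (zeroʳ k) +ₚ.refl

  open SetoidReasoning ≋-setoid

  *ₚ-zeroʳ : ∀ p → p *ₚ [] ≋ []
  *ₚ-zeroʳ []      = +ₚ.refl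
  *ₚ-zeroʳ (x ∷ p) = coeffwise λ { zero → refl ; (suc n) → coeff≈ (*ₚ-zeroʳ p) n }

  *ₚ-consʳ : ∀ p y r → p *ₚ (y ∷ r) ≋ scale y p +ₚ X· (p *ₚ r)
  *ₚ-consʳ []      y r = +ₚ.sym X·-zero
  *ₚ-consʳ (x ∷ p) y r = ∷-cong (+-congʳ (*-comm x y)) (begin
    scale x r +ₚ (p *ₚ (y ∷ r))                 ≈⟨ +ₚ.∙-congˡ (*ₚ-consʳ p y r) ⟩
    scale x r +ₚ (scale y p +ₚ X· (p *ₚ r))     ≈⟨ x∙yz≈y∙xz (scale x r) (scale y p) (X· (p *ₚ r)) ⟩
    scale y p +ₚ (scale x r +ₚ X· (p *ₚ r))     ∎)

  *ₚ-comm : ∀ p r → p *ₚ r ≋ r *ₚ p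
  *ₚ-comm []      r = +ₚ.sym (*ₚ-zeroʳ r)
  *ₚ-comm (x ∷ p) r = begin
    scale x r +ₚ X· (p *ₚ r)     ≈⟨ +ₚ.∙-congˡ (∷-cong refl (*ₚ-comm p r)) ⟩
    scale x r +ₚ X· (r *ₚ p)     ≈⟨ *ₚ-consʳ r x p ⟨
    r *ₚ (x ∷ p)                 ∎

  *ₚ-congˡ : ∀ p → r ≋ r' → p *ₚ r ≋ p *ₚ r'
  *ₚ-congˡ []      e = +ₚ.refl
  *ₚ-congˡ (x ∷ p) e = +ₚ.∙-cong (scale-cong e) (∷-cong refl (*ₚ-congˡ p e))

  *ₚ-cong : p ≋ p' → r ≋ r' → p *ₚ r ≋ p' *ₚ r'
  *ₚ-cong {p} {p'} {r} {r'} e f = begin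
    p *ₚ r      ≈⟨ *ₚ-congˡ p f ⟩
    p *ₚ r'     ≈⟨ *ₚ-comm p r' ⟩
    r' *ₚ p     ≈⟨ *ₚ-congˡ r' e ⟩
    r' *ₚ p'    ≈⟨ *ₚ-comm r' p' ⟩
    p' *ₚ r'    ∎

  *ₚ-distribʳ : ∀ r p p' → (p +ₚ p') *ₚ r ≋ (p *ₚ r) +ₚ (p' *ₚ r)
  *ₚ-distribʳ r []      p'       = +ₚ.refl
  *ₚ-distribʳ r (x ∷ p) []       = +ₚ.sym (+ₚ.identityʳ _)
  *ₚ-distribʳ r (x ∷ p) (y ∷ p') = begin
    scale (x + y) r +ₚ X· ((p +ₚ p') *ₚ r)
      ≈⟨ +ₚ.∙-cong (scale-distribʳ x y r) (∷-cong refl (*ₚ-distribʳ r p p')) ⟩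
    (scale x r +ₚ scale y r) +ₚ X· ((p *ₚ r) +ₚ (p' *ₚ r))
      ≈⟨ +ₚ.∙-congˡ (X·-+ₚ (p *ₚ r) (p' *ₚ r)) ⟩
    (scale x r +ₚ scale y r) +ₚ (X· (p *ₚ r) +ₚ X· (p' *ₚ r))
      ≈⟨ interchange (scale x r) _ _ _ ⟩
    (scale x r +ₚ X· (p *ₚ r)) +ₚ (scale y r +ₚ X· (p' *ₚ r)) ∎

  *ₚ-distribˡ : ∀ p r r' → p *ₚ (r +ₚ r') ≋ (p *ₚ r) +ₚ (p *ₚ r')
  *ₚ-distribˡ p r r' = begin
    p *ₚ (r +ₚ r')          ≈⟨ *ₚ-comm p (r +ₚ r') ⟩
    (r +ₚ r') *ₚ p          ≈⟨ *ₚ-distribʳ p r r' ⟩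
    (r *ₚ p) +ₚ (r' *ₚ p)   ≈⟨ +ₚ.∙-cong (*ₚ-comm r p) (*ₚ-comm r' p) ⟩
    (p *ₚ r) +ₚ (p *ₚ r')   ∎

  scale-*ₚ : ∀ k p r → scale k p *ₚ r ≋ scale k (p *ₚ r)
  scale-*ₚ k []      r = +ₚ.refl
  scale-*ₚ k (x ∷ p) r = begin
    scale (k * x) r +ₚ X· (scale k p *ₚ r)       ≈⟨ +ₚ.∙-cong (scale-* k x r) (∷-cong refl (scale-*ₚ k p r)) ⟩
    scale k (scale x r) +ₚ X· scale k (p *ₚ r)   ≈⟨ +ₚ.∙-congˡ (scale-X· k (p *ₚ r)) ⟨
    scale k (scale x r) +ₚ scale k (X· (p *ₚ r)) ≈⟨ scale-+ₚ k (scale x r) _ ⟨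
    scale k (scale x r +ₚ X· (p *ₚ r))          ∎

  *ₚ-assoc : ∀ p r s → (p *ₚ r) *ₚ s ≋ p *ₚ (r *ₚ s)
  *ₚ-assoc []      r s = +ₚ.refl
  *ₚ-assoc (x ∷ p) r s = begin
    (scale x r +ₚ X· (p *ₚ r)) *ₚ s            ≈⟨ *ₚ-distribʳ s (scale x r) _ ⟩
    (scale x r *ₚ s) +ₚ (X· (p *ₚ r) *ₚ s)     ≈⟨ +ₚ.∙-cong (scale-*ₚ x r s) (+ₚ.∙-congʳ (scale-zero s)) ⟩
    scale x (r *ₚ s) +ₚ X· ((p *ₚ r) *ₚ s)     ≈⟨ +ₚ.∙-congˡ (∷-cong refl (*ₚ-assoc p r s)) ⟩
    scale x (r *ₚ s) +ₚ X· (p *ₚ (r *ₚ s))     ∎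

  const-*ₚ : ∀ k p → const k *ₚ p ≋ scale k p
  const-*ₚ k p = begin
    scale k p +ₚ X· []   ≈⟨ +ₚ.∙-congˡ X·-zero ⟩
    scale k p +ₚ []      ≈⟨ +ₚ.identityʳ (scale k p) ⟩
    scale k p            ∎

  *ₚ-identityˡ : ∀ p → const 1# *ₚ p ≋ p
  *ₚ-identityˡ p = +ₚ.trans (const-*ₚ 1# p) (scale-one p)

  polynomialRing : CommutativeRing r₁ r₂
  polynomialRing = record
    { Carrier = Poly ; _≈_ = _≋_ ; _+_ = _+ₚ_ ; _*_ = _*ₚ_ ; -_ = -ₚ_ ; 0# = [] ; 1# = const 1#
    ; isCommutativeRing = record
      { isRing = record
        { +-isAbelianGroup = +ₚ.isAbelianGroup
        ; *-cong = *ₚ-cong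
        ; *-assoc = *ₚ-assoc
        ; *-identity = *ₚ-identityˡ , λ p → +ₚ.trans (*ₚ-comm p (const 1#)) (*ₚ-identityˡ p)
        ; distrib = *ₚ-distribˡ , *ₚ-distribʳ }
      ; *-comm = *ₚ-comm }
    }

module ConstantIsometries {r₁ r₂} (F : FiniteOddField r₁ r₂) where

  open FiniteOddField F hiding (zero)
  open Forms F
  open Polynomials F
  open SetoidReasoning setoid
  private
    module Fₘ = BinaryForms commRing
    module Pₘ = BinaryForms polynomialRing
    module ℙ = CommutativeRing polynomialRing using (trans; +-cong)

  coeff-const-*ₚ : ∀ k p n → coeff (const k *ₚ p) n ≈ k * coeff p n
  coeff-const-*ₚ k p n = trans (coeff≈ (const-*ₚ k p) n) (coeff-scale k p n)

  coeff-*ₚ-const : ∀ {k} p r n → r ≋ const k → coeff (p *ₚ r) n ≈ coeff p n * k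
  coeff-*ₚ-const {k} p r n r≋k = begin
    coeff (p *ₚ r) n          ≈⟨ coeff≈ (ℙ.trans (*ₚ-congˡ p r≋k) (*ₚ-comm p (const k))) n ⟩
    coeff (const k *ₚ p) n    ≈⟨ coeff-const-*ₚ k p n ⟩
    k * coeff p n             ≈⟨ *-comm k _ ⟩
    coeff p n * k             ∎

  const-*ₚ-const : ∀ u w → const u *ₚ const w ≋ const (u * w)
  const-*ₚ-const u w = const-*ₚ u (const w)

  coeff-form-const : ∀ α β γ u w n →
    coeff (Pₘ.form α β γ (const u) (const w)) n ≈ Fₘ.form (coeff α n) (coeff β n) (coeff γ n) u w
  coeff-form-const α β γ u w n = begin
    coeff ((A +ₚ B) +ₚ C) n                   ≈⟨ coeff-+ₚ (A +ₚ B) C n ⟩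
    coeff (A +ₚ B) n + coeff C n              ≈⟨ +-congʳ (coeff-+ₚ A B n) ⟩
    coeff A n + coeff B n + coeff C n
      ≈⟨ +-cong (+-cong (coeff-*ₚ-const α _ n (const-*ₚ-const u u))
                        (trans (coeff-const-*ₚ two (β *ₚ (const u *ₚ const w)) n)
                               (*-congˡ (coeff-*ₚ-const β _ n (const-*ₚ-const u w)))))
                (coeff-*ₚ-const γ _ n (const-*ₚ-const w w)) ⟩
    Fₘ.form (coeff α n) (coeff β n) (coeff γ n) u w ∎
    where
    A B C : Poly
    A = α *ₚ (const u *ₚ const u)
    B = const two *ₚ (β *ₚ (const u *ₚ const w))
    C = γ *ₚ (const w *ₚ const w)

  coeff-polar-const : ∀ α β γ s s' t t' n →
    coeff (Pₘ.polar α β γ (const s) (const s') (const t) (const t')) n ≈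
    Fₘ.polar (coeff α n) (coeff β n) (coeff γ n) s s' t t'
  coeff-polar-const α β γ s s' t t' n = begin
    coeff ((A +ₚ B) +ₚ C) n                   ≈⟨ coeff-+ₚ (A +ₚ B) C n ⟩
    coeff (A +ₚ B) n + coeff C n              ≈⟨ +-congʳ (coeff-+ₚ A B n) ⟩
    coeff A n + coeff B n + coeff C n
      ≈⟨ +-cong (+-cong (coeff-*ₚ-const α _ n (const-*ₚ-const s t))
                        (coeff-*ₚ-const β _ n (ℙ.+-cong (const-*ₚ-const s t') (const-*ₚ-const s' t))))
                (coeff-*ₚ-const γ _ n (const-*ₚ-const s' t')) ⟩
    Fₘ.polar (coeff α n) (coeff β n) (coeff γ n) s s' t t' ∎
    where
    A B C : Poly
    A = α *ₚ (const s *ₚ const t)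
    B = β *ₚ ((const s *ₚ const t') +ₚ (const s' *ₚ const t))
    C = γ *ₚ (const s' *ₚ const t')

  constMatrix : Fₘ.Matrix → Mat
  constMatrix (Fₘ.matrix s t s' t') = mat (const s) (const t) (const s') (const t')

  const-dot : ∀ {a b a' b' k} → a * b + a' * b' ≈ k →
              ((const a *ₚ const b) +ₚ (const a' *ₚ const b')) ≈ₚ const k
  const-dot a·b≈k zero    = trans (+-cong (+-identityʳ _) (+-identityʳ _)) a·b≈k
  const-dot a·b≈k (suc n) = refl

  constMatrix-involution : ∀ U → Fₘ.IsInvolution U → (constMatrix U · constMatrix U) ≈ₘ I₂
  constMatrix-involution (Fₘ.matrix s t s' t') (e₁₁ , e₁₂ , e₂₁ , e₂₂) =
    const-dot e₁₁ , const-dot e₁₂ , const-dot e₂₁ , const-dot e₂₂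

  constMatrix-sends : ∀ U {x y x' y'} → Fₘ.Sends U x y x' y' →
    let (u , v) = act (constMatrix U) (const x , const y) in (u ≈ₚ const x') × (v ≈ₚ const y')
  constMatrix-sends (Fₘ.matrix s t s' t') (e₁ , e₂) = const-dot e₁ , const-dot e₂

  constMatrix-automorphism : ∀ α β γ U → Fₘ.IsInvolution U →
    (∀ n → Fₘ.Preserves U (coeff α n) (coeff β n) (coeff γ n)) → InAut α β γ (constMatrix U)
  constMatrix-automorphism α β γ U@(Fₘ.matrix s t s' t') involution preserves =
    (constMatrix U , constMatrix-involution U involution , constMatrix-involution U involution) ,
    λ x y → coeff≈ (Pₘ.preserves⇒form-invariant {const s} {const t} {const s'} {const t'} lifted x y)
    where
    lifted : Pₘ.Preserves (Pₘ.matrix (const s) (const t) (const s') (const t')) α β γ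
    lifted =
      coeffwise (λ n → trans (coeff-form-const α β γ s s' n) (proj₁ (preserves n))) ,
      coeffwise (λ n → trans (coeff-polar-const α β γ s s' t t' n) (proj₁ (proj₂ (preserves n)))) ,
      coeffwise (λ n → trans (coeff-form-const α β γ t t' n) (proj₂ (proj₂ (preserves n))))

module _ {c ℓ} (F : FiniteOddField c ℓ) where
  open FiniteOddField F

  ≈-decidable : Decidable _≈_
  ≈-decidable x y = map′ from-injective from-cong (from x Fin.≟ from y)
    where
    open Inverse enum using (to; from; from-cong; strictlyInverseˡ)
    from-injective : from x ≡.≡ from y → x ≈ y
    from-injective eq = trans (sym (strictlyInverseˡ x)) (trans (reflexive (≡.cong to eq)) (strictlyInverseˡ y))

lemma6p7 : ∀ {c ℓ : Level} (F : FiniteOddField c ℓ) →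
    let open FiniteOddField F in
    let open Forms F in
    ∀ (α β γ : Poly) → Definite α β γ →
    ∀ (μ : ℕ) → HasDeg α μ → HasDeg γ μ → DegLt β μ →
    ∀ (a : Poly) → HasDeg a μ → (∃[ x ] ∃[ y ] (Q α β γ x y ≈ₚ a)) →
    ∀ (x y x' y' : Carrier) →
    Q α β γ (const x) (const y) ≈ₚ a →
    Q α β γ (const x') (const y') ≈ₚ a →
    ∃[ U ] (InAut α β γ U ×
    (let (u , v) = act U (const x , const y) in (u ≈ₚ const x') × (v ≈ₚ const y')))
lemma6p7 F α β γ _ μ _ _ _ a (a[μ]≉0 , _) _ x y x' y' Q[v]≈a Q[v']≈a =
  let U , involution , sends , preserves =
        exchanging-involution inverse (≈-decidable F) A B C μ q[v]≉0 q[v]≈q[v']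
  in constMatrix U , constMatrix-automorphism α β γ U involution preserves , constMatrix-sends U sends
  where
  open FiniteOddField F
  open Forms F
  open ConstantIsometries F
  open BinaryForms commRing using (form)
  open DiscreteFieldForms commRing
  A B C : ℕ → Carrier
  A = coeff α
  B = coeff β
  C = coeff γ
  q[v]≈q[v'] : ∀ n → form (A n) (B n) (C n) x y ≈ form (A n) (B n) (C n) x' y'
  q[v]≈q[v'] n = trans (sym (coeff-form-const α β γ x y n))
                 (trans (Q[v]≈a n) (trans (sym (Q[v']≈a n)) (coeff-form-const α β γ x' y' n)))
  q[v]≉0 : ¬ form (A μ) (B μ) (C μ) x y ≈ 0#
  q[v]≉0 q[v]≈0 = a[μ]≉0 (trans (sym (Q[v]≈a μ)) (trans (coeff-form-const α β γ x y μ) q[v]≈0))
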